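{- Let $I$ be an independent set in $\mathrm{PLC}(k,n)$. Then $|I|\leqslant k^2$. Moreover, equality holds if and only if $I$ contains exactly one cut vertex $(i,S)$ for each $1\le i\le k$ and exactly one pairing vertex $(i,j,S,S')$ for each ordered pair $1\le i\ne j\le k$.
   Context: $\log$ is the binary logarithm; $m:=\lfloor\log n\rfloor$. The graph $\mathrm{PLC}(k,n)$ has cut vertices $(i,S)$ for $i\in[k]$, $S\subseteq[m]$, and pairing vertices $(i,j,S,S')$ for $i\neq j\in[k]$, $S,S'\subseteq[m]$. Edges: cut vertices with the same first index $i$ are pairwise adjacent; pairing vertices with the same $(i,j)$ are pairwise adjacent; a cut vertex $(i,S)$ is adjacent to a pairing vertex $(j_1,j_2,S_1,S_2)$ iff ($i=j_1$ and $S\neq S_1$) or ($i=j_2$ and $S\ne S_2$). No other edges. -}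

module Defs where

open import Data.Nat using (ℕ)
open import Data.Nat.Logarithm using (⌊log₂_⌋)
open import Data.Fin using (Fin)
open import Data.Fin.Subset using (Subset)
open import Data.List using (List)
open import Data.List.Relation.Unary.All using (All)
open import Data.List.Relation.Unary.AllPairs using (AllPairs)
open import Data.List.Relation.Unary.Unique.Propositional using (Unique)
open import Data.List.Membership.Propositional using (_∈_)
open import Data.Product using (_×_; ∃!; _,_; proj₁; proj₂)
open import Data.Sum using (_⊎_)
open import Data.Unit using (⊤)
open import Relation.Nullary using (¬_)
open import Relation.Binary.PropositionalEquality using (_≡_; _≢_)

-- m := ⌊log₂ n⌋ ; subsets of [m] are Data.Fin.Subset m
-- Vertex "candidates" of PLC(k,n).  Pairing candidates are allowed for
-- all i j; only those with i ≢ j are actual vertices (see IsVertex).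
data Vertex (k n : ℕ) : Set where
  cut  : Fin k → Subset ⌊log₂ n ⌋ → Vertex k n
  pair : Fin k → Fin k → Subset ⌊log₂ n ⌋ → Subset ⌊log₂ n ⌋ → Vertex k n

IsVertex : ∀ {k n} → Vertex k n → Set
IsVertex (cut i S) = ⊤
IsVertex (pair i j S S') = i ≢ j

Adj : ∀ {k n} → Vertex k n → Vertex k n → Set
Adj (cut i S) (cut i' S') = i ≡ i'
Adj (pair i j S S') (pair i' j' T T') = (i ≡ i') × (j ≡ j')
Adj (cut i S) (pair j₁ j₂ S₁ S₂) = ((i ≡ j₁) × (S ≢ S₁)) ⊎ ((i ≡ j₂) × (S ≢ S₂))
Adj (pair j₁ j₂ S₁ S₂) (cut i S) = ((i ≡ j₁) × (S ≢ S₁)) ⊎ ((i ≡ j₂) × (S ≢ S₂))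

-- an independent set, given as a duplicate-free list of vertices that are
-- pairwise non-adjacent; |I| = length of the list
IsIndependent : ∀ {k n} → List (Vertex k n) → Set
IsIndependent I = All IsVertex I × Unique I × AllPairs (λ u v → ¬ Adj u v) I

ExtremalShape : ∀ {k n} → List (Vertex k n) → Set
ExtremalShape {k} {n} I =
  ((i : Fin k) → ∃! _≡_ (λ S → cut i S ∈ I)) ×
  ((i j : Fin k) → i ≢ j → ∃! _≡_ (λ (p : Subset ⌊log₂ n ⌋ × Subset ⌊log₂ n ⌋) →
        pair i j (proj₁ p) (proj₂ p) ∈ I))

-- Give every vertex a class in [k] × [k]: (i,i) for a cut vertex (i,S) and (i,j) for a
-- pairing vertex (i,j,S,S').  Each class is a clique of PLC(k,n), so an independent set
-- meets each of the k² classes at most once, and it has k² elements exactly when it meets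
-- every class exactly once, which is the extremal shape.
module Submission where

open import Defs
open import Data.Nat using (ℕ; suc; _≤_; _^_; _*_)
open import Data.Nat.Properties using (*-identityʳ; ≤-antisym; 1+n≰n)
open import Data.Fin using (Fin; combine; punchOut; _≟_)
open import Data.Fin.Properties using (injective⇒≤; punchOut-injective; combine-injective; combine-surjective)
open import Data.Fin.Subset using (Subset)
open import Data.Nat.Logarithm using (⌊log₂_⌋)
open import Data.List using (List; length; lookup; map)
open import Data.List.Properties using (length-map)
open import Data.List.Relation.Unary.All using (All; []; _∷_)
import Data.List.Relation.Unary.All as All
open import Data.List.Relation.Unary.AllPairs using (AllPairs; []; _∷_)
import Data.List.Relation.Unary.AllPairs.Properties as AllPairs
open import Data.List.Relation.Unary.Any using (here; there; index)
open import Data.List.Relation.Unary.Any.Properties using (lookup-index)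
open import Data.List.Relation.Unary.Unique.Propositional using (Unique)
open import Data.List.Membership.Propositional using (_∈_)
open import Data.List.Membership.Propositional.Properties using (∈-lookup; ∈-map⁺; ∈-map⁻)
import Data.List.Membership.DecPropositional as DecMembership
open import Data.Product using (_×_; _,_; proj₁; proj₂; ∃-syntax; ∃!)
open import Function.Base using (_on_)
open import Function.Bundles using (_⇔_; mk⇔)
open import Function.Definitions using (Injective)
open import Relation.Nullary using (yes; no; contradiction)
open import Relation.Binary.PropositionalEquality using (_≡_; _≢_; refl; sym; trans; cong; subst)

module _ {a} {A : Set a} where

  Unique⇒lookup-injective : {xs : List A} → Unique xs → Injective _≡_ _≡_ (lookup xs)
  Unique⇒lookup-injective (_  ∷ _)  {Fin.zero}  {Fin.zero}  _ = refl
  Unique⇒lookup-injective (x∉ ∷ _)  {Fin.zero}  {Fin.suc q} e = contradiction e (All.lookup x∉ (∈-lookup q))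
  Unique⇒lookup-injective (x∉ ∷ _)  {Fin.suc p} {Fin.zero}  e = contradiction (sym e) (All.lookup x∉ (∈-lookup p))
  Unique⇒lookup-injective (_  ∷ xs!) {Fin.suc p} {Fin.suc q} e = cong Fin.suc (Unique⇒lookup-injective xs! e)

  AllPairs-≢-on⇒injective-∈ : ∀ {b} {B : Set b} (f : A → B) {xs : List A} →
    AllPairs (_≢_ on f) xs → ∀ {u v} → u ∈ xs → v ∈ xs → f u ≡ f v → u ≡ v
  AllPairs-≢-on⇒injective-∈ f (_  ∷ _)  (here refl) (here refl) _  = refl
  AllPairs-≢-on⇒injective-∈ f (x∉ ∷ _)  (here refl) (there v∈) e  = contradiction e (All.lookup x∉ v∈)
  AllPairs-≢-on⇒injective-∈ f (x∉ ∷ _)  (there u∈) (here refl) e  = contradiction (sym e) (All.lookup x∉ u∈)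
  AllPairs-≢-on⇒injective-∈ f (_  ∷ xs!) (there u∈) (there v∈) e = AllPairs-≢-on⇒injective-∈ f xs! u∈ v∈ e

  All∧AllPairs⇒AllPairs : ∀ {p r s} {P : A → Set p} {R : A → A → Set r} {S : A → A → Set s} →
    (∀ {x y} → P x → P y → R x y → S x y) → {xs : List A} → All P xs → AllPairs R xs → AllPairs S xs
  All∧AllPairs⇒AllPairs h []         []           = []
  All∧AllPairs⇒AllPairs h (px ∷ pxs) (rx ∷ rxs) =
    All.zipWith (λ (py , r) → h px py r) (pxs , rx) ∷ All∧AllPairs⇒AllPairs h pxs rxs

Unique⇒length≤ : ∀ {N} {ys : List (Fin N)} → Unique ys → length ys ≤ N
Unique⇒length≤ ys! = injective⇒≤ (Unique⇒lookup-injective ys!)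

-- A value t missing from ys would let punchOut t squeeze ys injectively into Fin (N - 1).
Unique∧length≡⇒∈ : ∀ {N} {ys : List (Fin N)} → Unique ys → length ys ≡ N → ∀ t → t ∈ ys
Unique∧length≡⇒∈ {suc N} {ys} ys! len≡ t with DecMembership._∈?_ _≟_ t ys
... | yes t∈ = t∈
... | no  t∉ = contradiction (subst (_≤ N) len≡ (injective⇒≤ squeeze-injective)) 1+n≰n
  where
  t≢ : ∀ p → t ≢ lookup ys p
  t≢ p t≡ = t∉ (subst (_∈ ys) (sym t≡) (∈-lookup p))
  squeeze-injective : Injective _≡_ _≡_ (λ p → punchOut (t≢ p))
  squeeze-injective e = Unique⇒lookup-injective ys! (punchOut-injective (t≢ _) (t≢ _) e)

complete⇒length≥ : ∀ {N} {ys : List (Fin N)} → (∀ t → t ∈ ys) → N ≤ length ys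
complete⇒length≥ {ys = ys} complete = injective⇒≤ position-injective
  where
  position-injective : Injective _≡_ _≡_ (λ t → index (complete t))
  position-injective {t} {t′} e =
    trans (lookup-index (complete t)) (trans (cong (lookup ys) e) (sym (lookup-index (complete t′))))

module _ {k n : ℕ} where

  class : Vertex k n → Fin (k * k)
  class (cut i _)      = combine i i
  class (pair i j _ _) = combine i j

  sameClass⇒Adj : {u v : Vertex k n} → IsVertex u → IsVertex v → class u ≡ class v → Adj u v
  sameClass⇒Adj {cut i _}      {cut i′ _}       _   _   e = proj₁ (combine-injective i i i′ i′ e)
  sameClass⇒Adj {pair i j _ _} {pair i′ j′ _ _} _   _   e = combine-injective i j i′ j′ e
  sameClass⇒Adj {cut i _}      {pair a b _ _}   _   a≢b e with i≡a , i≡b ← combine-injective i i a b e =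
    contradiction (trans (sym i≡a) i≡b) a≢b
  sameClass⇒Adj {pair a b _ _} {cut i _}        a≢b _   e with a≡i , b≡i ← combine-injective a b i i e =
    contradiction (trans a≡i (sym b≡i)) a≢b

  independent⇒classes-distinct : {I : List (Vertex k n)} → IsIndependent I → AllPairs (_≢_ on class) I
  independent⇒classes-distinct (vertices , _ , nonadjacent) =
    All∧AllPairs⇒AllPairs (λ u-vertex v-vertex ¬adj e → ¬adj (sameClass⇒Adj u-vertex v-vertex e))
      vertices nonadjacent

  cut-injective : ∀ {i S S′} → cut {k} {n} i S ≡ cut i S′ → S ≡ S′
  cut-injective refl = refl

  pair-injective : ∀ {i j S T S′ T′} → pair {k} {n} i j S T ≡ pair i j S′ T′ → (S , T) ≡ (S′ , T′)
  pair-injective refl = refl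

  module _ {I : List (Vertex k n)} where

    cut-of-class : All IsVertex I → ∀ {i} → combine i i ∈ map class I → ∃[ S ] cut i S ∈ I
    cut-of-class vertices c∈ with ∈-map⁻ class c∈
    ... | cut i′ S , v∈ , e with refl , _ ← combine-injective _ _ i′ i′ e = S , v∈
    ... | pair a b _ _ , v∈ , e with i≡a , i≡b ← combine-injective _ _ a b e =
      contradiction (trans (sym i≡a) i≡b) (All.lookup vertices v∈)

    pair-of-class : ∀ {i j} → i ≢ j → combine i j ∈ map class I →
      ∃[ p ] pair i j (proj₁ p) (proj₂ p) ∈ I
    pair-of-class i≢j c∈ with ∈-map⁻ class c∈
    ... | pair a b S T , v∈ , e with refl , refl ← combine-injective _ _ a b e = (S , T) , v∈
    ... | cut i′ _ , _ , e with i≡i′ , j≡i′ ← combine-injective _ _ i′ i′ e =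
      contradiction (trans i≡i′ (sym j≡i′)) i≢j

    classes-complete⇒extremal : IsIndependent I → (∀ t → t ∈ map class I) → ExtremalShape I
    classes-complete⇒extremal independent@(vertices , _) complete = cuts , pairs
      where
      same : ∀ {u v} → u ∈ I → v ∈ I → class u ≡ class v → u ≡ v
      same = AllPairs-≢-on⇒injective-∈ class (independent⇒classes-distinct independent)

      cuts : ∀ i → ∃! _≡_ λ S → cut i S ∈ I
      cuts i with S , S∈ ← cut-of-class vertices (complete (combine i i)) =
        S , S∈ , λ {_} S′∈ → cut-injective (same S∈ S′∈ refl)

      pairs : ∀ i j → i ≢ j →
        ∃! _≡_ λ (p : Subset ⌊log₂ n ⌋ × Subset ⌊log₂ n ⌋) → pair i j (proj₁ p) (proj₂ p) ∈ I
      pairs i j i≢j with p , p∈ ← pair-of-class i≢j (complete (combine i j)) =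
        p , p∈ , λ {_} p′∈ → pair-injective (same p∈ p′∈ refl)

    extremal⇒classes-complete : ExtremalShape I → ∀ t → t ∈ map class I
    extremal⇒classes-complete (cuts , pairs) t with i , j , refl ← combine-surjective {k} {k} t with i ≟ j
    ... | yes refl = ∈-map⁺ class (proj₁ (proj₂ (cuts i)))
    ... | no  i≢j  = ∈-map⁺ class (proj₁ (proj₂ (pairs i j i≢j)))

lemma10 : (k n : ℕ) (I : List (Vertex k n)) → IsIndependent I →
    (length I ≤ k ^ 2) × ((length I ≡ k ^ 2) ⇔ ExtremalShape I)
lemma10 k n I independent rewrite *-identityʳ k =
  length≤ ,
  mk⇔ (λ length≡ → classes-complete⇒extremal independent
                      (Unique∧length≡⇒∈ classes-unique (trans (length-map class I) length≡)))
      (λ extremal → ≤-antisym length≤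
                      (subst (k * k ≤_) (length-map class I)
                        (complete⇒length≥ (extremal⇒classes-complete extremal))))
  where
  classes-unique : Unique (map class I)
  classes-unique = AllPairs.map⁺ (independent⇒classes-distinct independent)

  length≤ : length I ≤ k * k
  length≤ = subst (_≤ k * k) (length-map class I) (Unique⇒length≤ classes-unique)
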